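{- Let $A$ be an $n\times n\times n$ integer hypermatrix and $C=\Xi(A)$. Then $A$ is a permutation hypermatrix if and only if $C$ is a corner-sum hypermatrix of order $n$ satisfying $\Xi^{ -1}(C)_{i,j,k}\in\{0,1\}$ for all $i,j,k\in[n]$.
   Context: A permutation hypermatrix is an $n\times n\times n$ $(0,1)$-array with exactly one nonzero entry in each line (fixing two of the three indices). $\Xi(A)_{i,j,k}=\sum_{a=1}^i\sum_{b=1}^j\sum_{c=1}^k A_{a,b,c}$ for $i,j,k\in[0,n]$. For an array $C$ indexed by $[0,n]^3$, $\Xi^{ -1}(C)_{i,j,k}=C_{i,j,k}-C_{i-1,j,k}-C_{i,j-1,k}-C_{i,j,k-1}+C_{i-1,j-1,k}+C_{i-1,j,k-1}+C_{i,j-1,k-1}-C_{i-1,j-1,k-1}$ for $i,j,k\in[n]$ (so $\Xi^{ -1}(\Xi(A))=A$). A corner-sum hypermatrix of order $n$ is an integer array $C$ indexed by $[0,n]^3$ with $C_{i,j,0}=C_{i,0,j}=C_{0,i,j}=0$, $C_{i,j,n}=C_{i,n,j}=C_{n,i,j}=ij$ for all $i,j\in[0,n]$, and for all $i,j\in[0,n]$, $1\le k\le n$, each of $C_{i,j,k}-C_{i,j,k-1}$, $C_{i,k,j}-C_{i,k-1,j}$, $C_{k,i,j}-C_{k-1,i,j}$ in $\{\max(0,i+j-n),\dots,\min(i,j)\}$. -}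

module Defs where

open import Data.Nat as ℕ using (ℕ; zero; suc; _∸_; _⊓_)
open import Data.Integer using (ℤ; +_; _+_; _-_; _≤_)
open import Data.Fin using (Fin; zero; suc; toℕ; inject₁; fromℕ)
open import Data.Product using (Σ-syntax; _×_)
open import Data.Sum using (_⊎_)
open import Relation.Binary.PropositionalEquality using (_≡_; _≢_)

-- Indices in [n] = {1..n} are represented by Fin n (the element i : Fin n
-- stands for toℕ i + 1); indices in [0,n] are represented by Fin (suc n)
-- (the element i stands for toℕ i).

Hyper : ℕ → Set
Hyper n = Fin n → Fin n → Fin n → ℤ

Hyper0 : ℕ → Set
Hyper0 n = Fin (suc n) → Fin (suc n) → Fin (suc n) → ℤ

Σupto : ∀ {n} → Fin (suc n) → (Fin n → ℤ) → ℤ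
Σupto zero f = + 0
Σupto {suc n} (suc i) f = f zero + Σupto i (λ a → f (suc a))

IsZeroOne : ∀ {n} → Hyper n → Set
IsZeroOne {n} A = ∀ (i j k : Fin n) → A i j k ≡ + 0 ⊎ A i j k ≡ + 1

ExactlyOne : ∀ {n} → (Fin n → Set) → Set
ExactlyOne {n} P = Σ[ x ∈ Fin n ] (P x × (∀ y → P y → y ≡ x))

IsPermutationHypermatrix : ∀ {n} → Hyper n → Set
IsPermutationHypermatrix {n} A =
  IsZeroOne A ×
  (∀ (j k : Fin n) → ExactlyOne (λ i → A i j k ≢ + 0)) ×
  (∀ (i k : Fin n) → ExactlyOne (λ j → A i j k ≢ + 0)) ×
  (∀ (i j : Fin n) → ExactlyOne (λ k → A i j k ≢ + 0))

Ξ : ∀ {n} → Hyper n → Hyper0 n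
Ξ A i j k = Σupto i (λ a → Σupto j (λ b → Σupto k (λ c → A a b c)))

-- Ξ⁻¹(C)_{i,j,k} for i,j,k ∈ [n]; (suc i) is the index i, (inject₁ i) is i-1
Ξinv : ∀ {n} → Hyper0 n → Hyper n
Ξinv C i j k =
  C i' j' k' - C i₀ j' k' - C i' j₀ k' - C i' j' k₀
  + C i₀ j₀ k' + C i₀ j' k₀ + C i' j₀ k₀ - C i₀ j₀ k₀
  where
  i' = suc i
  j' = suc j
  k' = suc k
  i₀ = inject₁ i
  j₀ = inject₁ j
  k₀ = inject₁ k

InRange : ℕ → ℕ → ℕ → ℤ → Set
InRange n i j d = (+ ((i ℕ.+ j) ∸ n) ≤ d) × (d ≤ + (i ⊓ j))

IsCornerSum : (n : ℕ) → Hyper0 n → Set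
IsCornerSum n C =
  (∀ (i j : Fin (suc n)) →
      (C i j zero ≡ + 0) × (C i zero j ≡ + 0) × (C zero i j ≡ + 0)) ×
  (∀ (i j : Fin (suc n)) →
      (C i j (fromℕ n) ≡ + (toℕ i ℕ.* toℕ j)) ×
      (C i (fromℕ n) j ≡ + (toℕ i ℕ.* toℕ j)) ×
      (C (fromℕ n) i j ≡ + (toℕ i ℕ.* toℕ j))) ×
  (∀ (i j : Fin (suc n)) (k : Fin n) →
      InRange n (toℕ i) (toℕ j) (C i j (suc k) - C i j (inject₁ k)) ×
      InRange n (toℕ i) (toℕ j) (C i (suc k) j - C i (inject₁ k) j) ×
      InRange n (toℕ i) (toℕ j) (C (suc k) i j - C (inject₁ k) i j))

module Submission where

-- Since Ξ⁻¹ ∘ Ξ = id, the (0,1) condition on Ξ⁻¹(C) is the (0,1) condition on A,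
-- and a (0,1)-array is a permutation hypermatrix iff all its line sums are 1.
-- The faces C_{i,j,n}, C_{i,n,j}, C_{n,i,j} are the rectangular prefix sums of
-- the three arrays of line sums, and these equal ij for all i, j exactly when
-- every line sum is 1.  Each step C_{i,j,k} - C_{i,j,k-1} (in any direction) is
-- a rectangular prefix sum S over an i×j corner of a slice of A, a nonnegative
-- matrix with unit row and column sums: so S ≤ min(i,j), and the mass i - S of
-- the first i rows lying outside the first j columns is at most the total mass
-- n - j outside those columns.

open import Defs
import Data.Nat as ℕ
open import Data.Nat using (ℕ; zero; suc)
import Data.Nat.Properties as ℕP
open import Data.Integer using (ℤ; +_; _+_; _-_; _*_; _≤_; +≤+; _≟_)
import Data.Integer.Properties as ℤP
open import Data.Integer.Tactic.RingSolver using (solve-∀)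
open import Algebra.Properties.AbelianGroup ℤP.+-0-abelianGroup using (∙-cancelˡ)
open import Data.Fin using (Fin; zero; suc; toℕ; inject₁; fromℕ)
open import Data.Fin.Properties using (toℕ-fromℕ; toℕ-inject₁; suc-injective)
open import Data.Empty using (⊥-elim)
open import Data.Product using (_×_; _,_; proj₁; proj₂)
open import Data.Sum using (_⊎_; inj₁; inj₂)
open import Function.Base using (_∘_)
open import Function.Bundles using (_⇔_; mk⇔; Equivalence)
open import Relation.Nullary using (¬_)
open import Relation.Nullary.Decidable using (decidable-stable)
open import Relation.Binary.PropositionalEquality

open Equivalence using (to; from)

total : ∀ {n} → (Fin n → ℤ) → ℤ
total = Σupto (fromℕ _)

Σupto-cong : ∀ {n} (p : Fin (suc n)) {f g : Fin n → ℤ} →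
  (∀ a → f a ≡ g a) → Σupto p f ≡ Σupto p g
Σupto-cong zero    f≗g = refl
Σupto-cong {suc n} (suc p) f≗g = cong₂ _+_ (f≗g zero) (Σupto-cong p (f≗g ∘ suc))

Σupto-const : ∀ {n} (p : Fin (suc n)) {f : Fin n → ℤ} (m : ℕ) →
  (∀ a → f a ≡ + m) → Σupto p f ≡ + (toℕ p ℕ.* m)
Σupto-const zero    m f≗m = refl
Σupto-const {suc n} (suc p) m f≗m = cong₂ _+_ (f≗m zero) (Σupto-const p m (f≗m ∘ suc))

Σupto-zero : ∀ {n} (p : Fin (suc n)) {f : Fin n → ℤ} →
  (∀ a → f a ≡ + 0) → Σupto p f ≡ + 0
Σupto-zero p f≗0 = trans (Σupto-const p 0 f≗0) (cong +_ (ℕP.*-zeroʳ (toℕ p)))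

Σupto-ones : ∀ {n} (p : Fin (suc n)) {f : Fin n → ℤ} →
  (∀ a → f a ≡ + 1) → Σupto p f ≡ + toℕ p
Σupto-ones p f≗1 = trans (Σupto-const p 1 f≗1) (cong +_ (ℕP.*-identityʳ (toℕ p)))

Σupto-+ : ∀ {n} (p : Fin (suc n)) (f g : Fin n → ℤ) →
  Σupto p (λ a → f a + g a) ≡ Σupto p f + Σupto p g
Σupto-+ zero    f g = refl
Σupto-+ {suc n} (suc p) f g = trans (cong (_+_ (f zero + g zero)) (Σupto-+ p (f ∘ suc) (g ∘ suc)))
  (interchange (f zero) (g zero) (Σupto p (f ∘ suc)) (Σupto p (g ∘ suc)))
  where
  interchange : ∀ a b c d → a + b + (c + d) ≡ a + c + (b + d)
  interchange = solve-∀

Σupto-- : ∀ {n} (p : Fin (suc n)) (f g : Fin n → ℤ) →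
  Σupto p (λ a → f a - g a) ≡ Σupto p f - Σupto p g
Σupto-- zero    f g = refl
Σupto-- {suc n} (suc p) f g = trans (cong (_+_ (f zero - g zero)) (Σupto-- p (f ∘ suc) (g ∘ suc)))
  (interchange (f zero) (g zero) (Σupto p (f ∘ suc)) (Σupto p (g ∘ suc)))
  where
  interchange : ∀ a b c d → a - b + (c - d) ≡ a + c - (b + d)
  interchange = solve-∀

Σupto-swap : ∀ {m n} (p : Fin (suc m)) (q : Fin (suc n)) (f : Fin m → Fin n → ℤ) →
  Σupto p (λ a → Σupto q (f a)) ≡ Σupto q (λ b → Σupto p (λ a → f a b))
Σupto-swap zero    q f = sym (Σupto-zero q (λ _ → refl))
Σupto-swap {suc m} (suc p) q f = trans (cong (_+_ (Σupto q (f zero))) (Σupto-swap p q (f ∘ suc)))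
  (sym (Σupto-+ q (f zero) (λ b → Σupto p (λ a → f (suc a) b))))

Σupto-step : ∀ {n} (k : Fin n) (f : Fin n → ℤ) →
  Σupto (suc k) f - Σupto (inject₁ k) f ≡ f k
Σupto-step zero    f = trans (ℤP.+-identityʳ _) (ℤP.+-identityʳ _)
Σupto-step {suc n} (suc k) f = trans
  (cancel (f zero) (Σupto (suc k) (f ∘ suc)) (Σupto (inject₁ k) (f ∘ suc)))
  (Σupto-step k (f ∘ suc))
  where
  cancel : ∀ a b c → a + b - (a + c) ≡ b - c
  cancel = solve-∀

Σupto-nonneg : ∀ {n} (p : Fin (suc n)) {f : Fin n → ℤ} →
  (∀ a → + 0 ≤ f a) → + 0 ≤ Σupto p f
Σupto-nonneg zero            f≥0 = ℤP.≤-refl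
Σupto-nonneg {suc n} (suc p) f≥0 = ℤP.+-mono-≤ (f≥0 zero) (Σupto-nonneg p (f≥0 ∘ suc))

Σupto-mono : ∀ {n} (p : Fin (suc n)) {f g : Fin n → ℤ} →
  (∀ a → f a ≤ g a) → Σupto p f ≤ Σupto p g
Σupto-mono zero            f≤g = ℤP.≤-refl
Σupto-mono {suc n} (suc p) f≤g = ℤP.+-mono-≤ (f≤g zero) (Σupto-mono p (f≤g ∘ suc))

Σupto≤total : ∀ {n} (p : Fin (suc n)) {f : Fin n → ℤ} →
  (∀ a → + 0 ≤ f a) → Σupto p f ≤ total f
Σupto≤total zero            f≥0 = Σupto-nonneg (fromℕ _) f≥0
Σupto≤total {suc n} (suc p) {f} f≥0 = ℤP.+-monoʳ-≤ (f zero) (Σupto≤total p (f≥0 ∘ suc))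

nonneg+nonneg≡0 : ∀ {a b} → + 0 ≤ a → + 0 ≤ b → a + b ≡ + 0 → a ≡ + 0 × b ≡ + 0
nonneg+nonneg≡0 {+ a} {+ b} _ _ a+b≡0 =
  cong +_ (ℕP.m+n≡0⇒m≡0 a a+b≡0′) , cong +_ (ℕP.m+n≡0⇒n≡0 a a+b≡0′)
  where
  a+b≡0′ : a ℕ.+ b ≡ 0
  a+b≡0′ = ℤP.+-injective a+b≡0

total≡0⇒≡0 : ∀ {n} {f : Fin n → ℤ} → (∀ a → + 0 ≤ f a) → total f ≡ + 0 → ∀ a → f a ≡ + 0
total≡0⇒≡0 {suc n} {f} f≥0 Σf≡0 = λ where
    zero    → proj₁ head,tail≡0
    (suc a) → total≡0⇒≡0 (f≥0 ∘ suc) (proj₂ head,tail≡0) a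
  where
  head,tail≡0 : f zero ≡ + 0 × total (f ∘ suc) ≡ + 0
  head,tail≡0 = nonneg+nonneg≡0 (f≥0 zero) (Σupto-nonneg (fromℕ n) (f≥0 ∘ suc)) Σf≡0

module _ {n} {P : Fin (suc n) → Set} where

  exactlyOne-tail : ¬ P zero → ExactlyOne P → ExactlyOne (P ∘ suc)
  exactlyOne-tail ¬P0 (zero  , Px , _)      = ⊥-elim (¬P0 Px)
  exactlyOne-tail ¬P0 (suc x , Px , unique) = x , Px , λ y Py → suc-injective (unique (suc y) Py)

  exactlyOne-untail : ¬ P zero → ExactlyOne (P ∘ suc) → ExactlyOne P
  exactlyOne-untail ¬P0 (x , Px , unique) = suc x , Px , λ where
    zero    P0  → ⊥-elim (¬P0 P0)
    (suc y) Psy → cong suc (unique y Psy)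

  exactlyOne-head⇒¬tail : P zero → ExactlyOne P → ∀ y → ¬ P (suc y)
  exactlyOne-head⇒¬tail P0 (x , _ , unique) y Psy
    with () ← trans (unique (suc y) Psy) (sym (unique zero P0))

  head∧¬tail⇒exactlyOne : P zero → (∀ y → ¬ P (suc y)) → ExactlyOne P
  head∧¬tail⇒exactlyOne P0 ¬Ps = zero , P0 , λ where
    zero    _   → refl
    (suc y) Psy → ⊥-elim (¬Ps y Psy)

IsZeroOneLine : ∀ {n} → (Fin n → ℤ) → Set
IsZeroOneLine f = ∀ x → f x ≡ + 0 ⊎ f x ≡ + 1

zeroOne⇒nonneg : ∀ {x} → x ≡ + 0 ⊎ x ≡ + 1 → + 0 ≤ x
zeroOne⇒nonneg (inj₁ refl) = ℤP.≤-refl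
zeroOne⇒nonneg (inj₂ refl) = +≤+ ℕ.z≤n

≡1⇒≢0 : ∀ {x} → x ≡ + 1 → x ≢ + 0
≡1⇒≢0 refl ()

exactlyOne⇒total≡1 : ∀ {n} (f : Fin n → ℤ) → IsZeroOneLine f →
  ExactlyOne (λ x → f x ≢ + 0) → total f ≡ + 1
exactlyOne⇒total≡1 {zero}  f zeroOne (() , _)
exactlyOne⇒total≡1 {suc n} f zeroOne one with zeroOne zero
... | inj₁ f0≡0 = cong₂ _+_ f0≡0
  (exactlyOne⇒total≡1 (f ∘ suc) (zeroOne ∘ suc) (exactlyOne-tail (λ f0≢0 → f0≢0 f0≡0) one))
... | inj₂ f0≡1 = cong₂ _+_ f0≡1 (Σupto-zero (fromℕ n) tail≡0)
  where
  tail≡0 : ∀ y → f (suc y) ≡ + 0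
  tail≡0 y = decidable-stable (f (suc y) ≟ + 0)
    (exactlyOne-head⇒¬tail (≡1⇒≢0 f0≡1) one y)

total≡1⇒exactlyOne : ∀ {n} (f : Fin n → ℤ) → IsZeroOneLine f →
  total f ≡ + 1 → ExactlyOne (λ x → f x ≢ + 0)
total≡1⇒exactlyOne {zero}  f zeroOne ()
total≡1⇒exactlyOne {suc n} f zeroOne Σf≡1 with zeroOne zero
... | inj₁ f0≡0 = exactlyOne-untail (λ f0≢0 → f0≢0 f0≡0)
  (total≡1⇒exactlyOne (f ∘ suc) (zeroOne ∘ suc)
    (trans (sym (ℤP.+-identityˡ _)) (trans (cong (_+ total (f ∘ suc)) (sym f0≡0)) Σf≡1)))
... | inj₂ f0≡1 = head∧¬tail⇒exactlyOne (≡1⇒≢0 f0≡1)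
  (λ y fy≢0 → fy≢0 (total≡0⇒≡0 (zeroOne⇒nonneg ∘ zeroOne ∘ suc) tail≡0 y))
  where
  tail≡0 : total (f ∘ suc) ≡ + 0
  tail≡0 = ∙-cancelˡ (+ 1) _ (+ 0) (trans (cong (_+ total (f ∘ suc)) (sym f0≡1)) Σf≡1)

HasUnitLineSums : ∀ {n} → Hyper n → Set
HasUnitLineSums A =
  (∀ j k → total (λ i → A i j k) ≡ + 1) ×
  (∀ i k → total (λ j → A i j k) ≡ + 1) ×
  (∀ i j → total (λ k → A i j k) ≡ + 1)

isPermutation⇔zeroOne×unitLineSums : ∀ {n} (A : Hyper n) →
  IsPermutationHypermatrix A ⇔ (IsZeroOne A × HasUnitLineSums A)
isPermutation⇔zeroOne×unitLineSums A = mk⇔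
  (λ (zeroOne , oneᵢ , oneⱼ , oneₖ) → zeroOne ,
      (λ j k → exactlyOne⇒total≡1 _ (λ i → zeroOne i j k) (oneᵢ j k)) ,
      (λ i k → exactlyOne⇒total≡1 _ (λ j → zeroOne i j k) (oneⱼ i k)) ,
      (λ i j → exactlyOne⇒total≡1 _ (λ k → zeroOne i j k) (oneₖ i j)))
  (λ (zeroOne , sumᵢ , sumⱼ , sumₖ) → zeroOne ,
      (λ j k → total≡1⇒exactlyOne _ (λ i → zeroOne i j k) (sumᵢ j k)) ,
      (λ i k → total≡1⇒exactlyOne _ (λ j → zeroOne i j k) (sumⱼ i k)) ,
      (λ i j → total≡1⇒exactlyOne _ (λ k → zeroOne i j k) (sumₖ i j)))

rectSum : ∀ {n} → Fin (suc n) → Fin (suc n) → (Fin n → Fin n → ℤ) → ℤ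
rectSum p q F = Σupto p (λ a → Σupto q (F a))

rectSum-cong : ∀ {n} (p q : Fin (suc n)) {F G : Fin n → Fin n → ℤ} →
  (∀ a b → F a b ≡ G a b) → rectSum p q F ≡ rectSum p q G
rectSum-cong p q F≗G = Σupto-cong p (λ a → Σupto-cong q (F≗G a))

rectSum-transpose : ∀ {n} (p q : Fin (suc n)) (F : Fin n → Fin n → ℤ) →
  rectSum p q F ≡ rectSum q p (λ b a → F a b)
rectSum-transpose p q F = Σupto-swap p q F

rectSum-- : ∀ {n} (p q : Fin (suc n)) (F G : Fin n → Fin n → ℤ) →
  rectSum p q F - rectSum p q G ≡ rectSum p q (λ a b → F a b - G a b)
rectSum-- p q F G = trans (sym (Σupto-- p _ _)) (Σupto-cong p (λ a → sym (Σupto-- q (F a) (G a))))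

rectSum-Σupto-step : ∀ {n} (p q : Fin (suc n)) (F : Fin n → Fin n → Fin n → ℤ) (k : Fin n) →
  rectSum p q (λ a b → Σupto (suc k) (F a b)) - rectSum p q (λ a b → Σupto (inject₁ k) (F a b))
    ≡ rectSum p q (λ a b → F a b k)
rectSum-Σupto-step p q F k = trans (rectSum-- p q _ _) (rectSum-cong p q (λ a b → Σupto-step k (F a b)))

Δ² : ∀ {n} → (Fin (suc n) → Fin (suc n) → ℤ) → Fin n → Fin n → ℤ
Δ² G i j = G (suc i) (suc j) - G (inject₁ i) (suc j) - G (suc i) (inject₁ j) + G (inject₁ i) (inject₁ j)

Δ²-cong : ∀ {n} {G H : Fin (suc n) → Fin (suc n) → ℤ} →
  (∀ p q → G p q ≡ H p q) → ∀ i j → Δ² G i j ≡ Δ² H i j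
Δ²-cong G≗H i j = cong₂ _+_
  (cong₂ _-_ (cong₂ _-_ (G≗H (suc i) (suc j)) (G≗H (inject₁ i) (suc j))) (G≗H (suc i) (inject₁ j)))
  (G≗H (inject₁ i) (inject₁ j))

Δ²-product : ∀ {n} (i j : Fin n) → Δ² (λ p q → + (toℕ p ℕ.* toℕ q)) i j ≡ + 1
Δ²-product i j rewrite toℕ-inject₁ i | toℕ-inject₁ j = begin
    + (suc x ℕ.* suc y) - + (x ℕ.* suc y) - + (suc x ℕ.* y) + + (x ℕ.* y)
  ≡⟨ cong₂ _+_ (cong₂ _-_ (cong₂ _-_ (ℤP.pos-* (suc x) (suc y)) (ℤP.pos-* x (suc y)))
                          (ℤP.pos-* (suc x) y))
               (ℤP.pos-* x y) ⟩
    (+ 1 + + x) * (+ 1 + + y) - + x * (+ 1 + + y) - (+ 1 + + x) * + y + + x * + y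
  ≡⟨ expand (+ x) (+ y) ⟩
    + 1 ∎
  where
  open ≡-Reasoning
  x y : ℕ
  x = toℕ i
  y = toℕ j
  expand : ∀ a b → (+ 1 + a) * (+ 1 + b) - a * (+ 1 + b) - (+ 1 + a) * b + a * b ≡ + 1
  expand = solve-∀

rectSum-step² : ∀ {n} (F : Fin n → Fin n → ℤ) (i j : Fin n) →
  Δ² (λ p q → rectSum p q F) i j ≡ F i j
rectSum-step² F i j = begin
    R (suc i) (suc j) - R (inject₁ i) (suc j) - R (suc i) (inject₁ j) + R (inject₁ i) (inject₁ j)
  ≡⟨ regroup (R (suc i) (suc j)) (R (inject₁ i) (suc j))
             (R (suc i) (inject₁ j)) (R (inject₁ i) (inject₁ j)) ⟩
    (R (suc i) (suc j) - R (inject₁ i) (suc j)) - (R (suc i) (inject₁ j) - R (inject₁ i) (inject₁ j))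
  ≡⟨ cong₂ _-_ (Σupto-step i (λ a → Σupto (suc j) (F a)))
               (Σupto-step i (λ a → Σupto (inject₁ j) (F a))) ⟩
    Σupto (suc j) (F i) - Σupto (inject₁ j) (F i)
  ≡⟨ Σupto-step j (F i) ⟩
    F i j ∎
  where
  open ≡-Reasoning
  R : Fin _ → Fin _ → ℤ
  R p q = rectSum p q F
  regroup : ∀ a b c d → a - b - c + d ≡ (a - b) - (c - d)
  regroup = solve-∀

rectSum≡*⇔≡1 : ∀ {n} (F : Fin n → Fin n → ℤ) →
  (∀ p q → rectSum p q F ≡ + (toℕ p ℕ.* toℕ q)) ⇔ (∀ a b → F a b ≡ + 1)
rectSum≡*⇔≡1 F = mk⇔
  (λ R≡* i j → trans (sym (rectSum-step² F i j)) (trans (Δ²-cong R≡* i j) (Δ²-product i j)))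
  (λ F≗1 p q → Σupto-const p (toℕ q) (λ a → Σupto-ones q (F≗1 a)))

inRange-from-bounds : ∀ n {i j S} → + 0 ≤ S → S ≤ + i → S ≤ + j →
  + i - S ≤ + n - + j → InRange n i j S
inRange-from-bounds n {i} {j} {+ s} _ (+≤+ s≤i) (+≤+ s≤j) i-s≤n-j =
  +≤+ (ℕP.m≤n+o⇒m∸n≤o (i ℕ.+ j) n (ℤP.drop‿+≤+ i+j≤n+s)) , +≤+ (ℕP.⊓-glb s≤i s≤j)
  where
  i+j≤n+s : + i + + j ≤ + n + + s
  i+j≤n+s = subst₂ _≤_ (cancelˡ (+ i) (+ j) (+ s)) (cancelʳ (+ n) (+ s) (+ j))
    (ℤP.+-monoˡ-≤ (+ s + + j) i-s≤n-j)
    where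
    cancelˡ : ∀ a b c → a - c + (c + b) ≡ a + b
    cancelˡ = solve-∀
    cancelʳ : ∀ a b c → a - c + (b + c) ≡ a + b
    cancelʳ = solve-∀

rectSum≤rows : ∀ {n} (M : Fin n → Fin n → ℤ) → (∀ a b → + 0 ≤ M a b) →
  (∀ a → total (M a) ≡ + 1) → ∀ i j → rectSum i j M ≤ + toℕ i
rectSum≤rows M M≥0 rows i j = ℤP.≤-trans (Σupto-mono i (λ a → Σupto≤total j (M≥0 a)))
  (ℤP.≤-reflexive (Σupto-ones i rows))

rectSum-inRange : ∀ {n} (M : Fin n → Fin n → ℤ) → (∀ a b → + 0 ≤ M a b) →
  (∀ a → total (M a) ≡ + 1) → (∀ b → total (λ a → M a b) ≡ + 1) →
  ∀ i j → InRange n (toℕ i) (toℕ j) (rectSum i j M)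
rectSum-inRange {n} M M≥0 rows cols i j = inRange-from-bounds n
  (Σupto-nonneg i (λ a → Σupto-nonneg j (M≥0 a)))
  (rectSum≤rows M M≥0 rows i j)
  (subst (_≤ + toℕ j) (sym (rectSum-transpose i j M))
    (rectSum≤rows (λ b a → M a b) (λ b a → M≥0 a b) cols j i))
  outside-columns
  where
  open ℤP.≤-Reasoning
  outside : Fin n → ℤ
  outside a = total (M a) - Σupto j (M a)
  outside-columns : + toℕ i - rectSum i j M ≤ + n - + toℕ j
  outside-columns = begin
      + toℕ i - rectSum i j M
    ≡⟨ cong (_- rectSum i j M) (Σupto-ones i rows) ⟨
      Σupto i (total ∘ M) - rectSum i j M
    ≡⟨ Σupto-- i _ _ ⟨
      Σupto i outside
    ≤⟨ Σupto≤total i (λ a → ℤP.i≤j⇒0≤j-i (Σupto≤total j (M≥0 a))) ⟩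
      total outside
    ≡⟨ Σupto-- (fromℕ n) _ _ ⟩
      total (total ∘ M) - rectSum (fromℕ n) j M
    ≡⟨ cong₂ _-_ (Σupto-ones (fromℕ n) rows)
                 (trans (rectSum-transpose (fromℕ n) j M) (Σupto-ones j cols)) ⟩
      + toℕ (fromℕ n) - + toℕ j
    ≡⟨ cong (λ m → + m - + toℕ j) (toℕ-fromℕ n) ⟩
      + n - + toℕ j ∎

Ξ≡rectSumᵢ : ∀ {n} (A : Hyper n) (i j k : Fin (suc n)) →
  Ξ A i j k ≡ rectSum j k (λ b c → Σupto i (λ a → A a b c))
Ξ≡rectSumᵢ A i j k = trans (Σupto-swap i j (λ a b → Σupto k (A a b)))
  (Σupto-cong j (λ b → Σupto-swap i k (λ a c → A a b c)))

Ξ≡rectSumⱼ : ∀ {n} (A : Hyper n) (i j k : Fin (suc n)) →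
  Ξ A i j k ≡ rectSum i k (λ a c → Σupto j (λ b → A a b c))
Ξ≡rectSumⱼ A i j k = Σupto-cong i (λ a → Σupto-swap j k (A a))

Ξinv≡Δ²-Δ² : ∀ {n} (C : Hyper0 n) (i j k : Fin n) →
  Ξinv C i j k ≡ Δ² (λ p q → C p q (suc k)) i j - Δ² (λ p q → C p q (inject₁ k)) i j
Ξinv≡Δ²-Δ² C i j k = regroup
  (C (suc i) (suc j) (suc k)) (C (inject₁ i) (suc j) (suc k))
  (C (suc i) (inject₁ j) (suc k)) (C (suc i) (suc j) (inject₁ k))
  (C (inject₁ i) (inject₁ j) (suc k)) (C (inject₁ i) (suc j) (inject₁ k))
  (C (suc i) (inject₁ j) (inject₁ k)) (C (inject₁ i) (inject₁ j) (inject₁ k))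
  where
  regroup : ∀ a b c d e f g h →
    a - b - c - d + e + f + g - h ≡ (a - b - c + e) - (d - f - g + h)
  regroup = solve-∀

Ξinv∘Ξ : ∀ {n} (A : Hyper n) (i j k : Fin n) → Ξinv (Ξ A) i j k ≡ A i j k
Ξinv∘Ξ A i j k = begin
    Ξinv (Ξ A) i j k
  ≡⟨ Ξinv≡Δ²-Δ² (Ξ A) i j k ⟩
    Δ² (λ p q → Ξ A p q (suc k)) i j - Δ² (λ p q → Ξ A p q (inject₁ k)) i j
  ≡⟨ cong₂ _-_ (rectSum-step² (λ a b → Σupto (suc k) (A a b)) i j)
               (rectSum-step² (λ a b → Σupto (inject₁ k) (A a b)) i j) ⟩
    Σupto (suc k) (A i j) - Σupto (inject₁ k) (A i j)
  ≡⟨ Σupto-step k (A i j) ⟩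
    A i j k ∎
  where open ≡-Reasoning

ZeroFaces : (n : ℕ) → Hyper0 n → Set
ZeroFaces n C = ∀ (i j : Fin (suc n)) →
  (C i j zero ≡ + 0) × (C i zero j ≡ + 0) × (C zero i j ≡ + 0)

FullFaces : (n : ℕ) → Hyper0 n → Set
FullFaces n C = ∀ (i j : Fin (suc n)) →
  (C i j (fromℕ n) ≡ + (toℕ i ℕ.* toℕ j)) ×
  (C i (fromℕ n) j ≡ + (toℕ i ℕ.* toℕ j)) ×
  (C (fromℕ n) i j ≡ + (toℕ i ℕ.* toℕ j))

StepsInRange : (n : ℕ) → Hyper0 n → Set
StepsInRange n C = ∀ (i j : Fin (suc n)) (k : Fin n) →
  InRange n (toℕ i) (toℕ j) (C i j (suc k) - C i j (inject₁ k)) ×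
  InRange n (toℕ i) (toℕ j) (C i (suc k) j - C i (inject₁ k) j) ×
  InRange n (toℕ i) (toℕ j) (C (suc k) i j - C (inject₁ k) i j)

Ξ-zeroFaces : ∀ {n} (A : Hyper n) → ZeroFaces n (Ξ A)
Ξ-zeroFaces A i j = Σupto-zero i (λ a → Σupto-zero j (λ b → refl)) , Σupto-zero i (λ a → refl) , refl

Ξ-fullFaces⇔unitLineSums : ∀ {n} (A : Hyper n) → FullFaces n (Ξ A) ⇔ HasUnitLineSums A
Ξ-fullFaces⇔unitLineSums {n} A = mk⇔
  (λ full →
      to (rectSum≡*⇔≡1 _) (λ p q → trans (sym (Ξ≡rectSumᵢ A (fromℕ n) p q)) (proj₂ (proj₂ (full p q)))) ,
      to (rectSum≡*⇔≡1 _) (λ p q → trans (sym (Ξ≡rectSumⱼ A p (fromℕ n) q)) (proj₁ (proj₂ (full p q)))) ,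
      to (rectSum≡*⇔≡1 _) (λ p q → proj₁ (full p q)))
  (λ (sumᵢ , sumⱼ , sumₖ) p q →
      from (rectSum≡*⇔≡1 _) sumₖ p q ,
      trans (Ξ≡rectSumⱼ A p (fromℕ n) q) (from (rectSum≡*⇔≡1 _) sumⱼ p q) ,
      trans (Ξ≡rectSumᵢ A (fromℕ n) p q) (from (rectSum≡*⇔≡1 _) sumᵢ p q))

Ξ-stepsInRange : ∀ {n} (A : Hyper n) → (∀ a b c → + 0 ≤ A a b c) →
  HasUnitLineSums A → StepsInRange n (Ξ A)
Ξ-stepsInRange {n} A A≥0 (sumᵢ , sumⱼ , sumₖ) i j k =
  subst (InRange n (toℕ i) (toℕ j)) (sym (rectSum-Σupto-step i j A k))
    (rectSum-inRange (λ a b → A a b k) (λ a b → A≥0 a b k) (λ a → sumⱼ a k) (λ b → sumᵢ b k) i j) ,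
  subst (InRange n (toℕ i) (toℕ j))
    (sym (trans (cong₂ _-_ (Ξ≡rectSumⱼ A i (suc k) j) (Ξ≡rectSumⱼ A i (inject₁ k) j))
                (rectSum-Σupto-step i j (λ a c b → A a b c) k)))
    (rectSum-inRange (λ a c → A a k c) (λ a c → A≥0 a k c) (λ a → sumₖ a k) (λ c → sumᵢ k c) i j) ,
  subst (InRange n (toℕ i) (toℕ j))
    (sym (trans (cong₂ _-_ (Ξ≡rectSumᵢ A (suc k) i j) (Ξ≡rectSumᵢ A (inject₁ k) i j))
                (rectSum-Σupto-step i j (λ b c a → A a b c) k)))
    (rectSum-inRange (λ b c → A k b c) (λ b c → A≥0 k b c) (λ b → sumₖ k b) (λ c → sumⱼ k c) i j)

IsZeroOne-resp : ∀ {n} {A B : Hyper n} → (∀ i j k → A i j k ≡ B i j k) → IsZeroOne A → IsZeroOne B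
IsZeroOne-resp A≗B zeroOne i j k = subst (λ x → x ≡ + 0 ⊎ x ≡ + 1) (A≗B i j k) (zeroOne i j k)

mainTheorem12 : (n : ℕ) (A : Hyper n) →
    IsPermutationHypermatrix A ⇔
      (IsCornerSum n (Ξ A) ×
       (∀ (i j k : Fin n) → Ξinv (Ξ A) i j k ≡ + 0 ⊎ Ξinv (Ξ A) i j k ≡ + 1))
mainTheorem12 n A = mk⇔
  (λ perm → let (zeroOne , sums) = to (isPermutation⇔zeroOne×unitLineSums A) perm in
    ( Ξ-zeroFaces A
    , from (Ξ-fullFaces⇔unitLineSums A) sums
    , Ξ-stepsInRange A (λ a b c → zeroOne⇒nonneg (zeroOne a b c)) sums)
    , IsZeroOne-resp (λ i j k → sym (Ξinv∘Ξ A i j k)) zeroOne)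
  (λ ((_ , full , _) , ΞinvΞ-zeroOne) → from (isPermutation⇔zeroOne×unitLineSums A)
    ( IsZeroOne-resp (Ξinv∘Ξ A) ΞinvΞ-zeroOne
    , to (Ξ-fullFaces⇔unitLineSums A) full))
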